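{- For every positive integer $k$, $\log_2\bigl(bl(k)+1\bigr) \leq \alpha(k)$.
   Context: For a finite family $\mathcal{S}=\{S_1,\dots,S_t\}$ of finite sets, $\mathbf{ID}(\mathcal{S})=2^{S_1}\cup\cdots\cup 2^{S_t}$ (all sets contained in some member of $\mathcal{S}$). For a positive integer $k$, $\alpha(k)$ is the minimum of $|\mathcal{S}|$ over all finite families $\mathcal{S}$ of finite sets with $|\mathbf{ID}(\mathcal{S})|=k$. The block count $bl(k)$ of a positive integer $k$ is the number of maximal runs of consecutive 1's in the binary expansion of $k$ (equivalently, the number $b$ in the unique representation of the binary expansion as $\mathbf{1}_{q_b}\mathbf{0}_{l_b}\cdots\mathbf{1}_{q_1}\mathbf{0}_{l_1}$ with $q_i>0$, $l_j>0$ for $j\geq2$, $l_1\geq 0$). -}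

module Defs where

open import Data.Nat using (ℕ; zero; suc; _+_; _/_; _%_; _≡ᵇ_)
open import Data.Bool using (Bool; _∧_; if_then_else_)
open import Data.List using (List; []; _∷_; _++_; map; length; filter)
open import Data.Vec using (_∷_; [])
open import Data.Fin.Subset using (Subset; _⊆_; inside; outside)
open import Data.Fin.Subset.Properties using (_⊆?_)
open import Data.List.Relation.Unary.Any using (Any; any?)

-- Block count bl(k): number of maximal runs of 1's in the binary expansion
-- of k, counted as the number of positions i with bit i = 1 and bit (i+1) = 0.
-- The first argument is fuel; fuel k suffices for input k.
blGo : ℕ → ℕ → ℕ
blGo zero    _ = 0
blGo (suc f) n =
  (if ((n % 2) ≡ᵇ 1) ∧ (((n / 2) % 2) ≡ᵇ 0) then 1 else 0) + blGo f (n / 2)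

bl : ℕ → ℕ
bl k = blGo k k

allSubsets : (n : ℕ) → List (Subset n)
allSubsets zero    = [] ∷ []
allSubsets (suc n) = map (outside ∷_) (allSubsets n) ++ map (inside ∷_) (allSubsets n)

ID : {n : ℕ} → List (Subset n) → List (Subset n)
ID {n} 𝒮 = filter (λ T → any? (λ S → T ⊆? S) 𝒮) (allSubsets n)

sizeID : {n : ℕ} → List (Subset n) → ℕ
sizeID 𝒮 = length (ID 𝒮)

-- Inclusion–exclusion gives |ID (S ∷ 𝒮)| = 2^|S| + |ID 𝒮| − |ID (map (S ∩_) 𝒮)|, so by induction on
-- the number t of sets, |ID 𝒮| is a signed sum of at most 2^t − 1 powers of two. Adding a power of
-- two to a number changes its block count by at most one, so bl k is bounded by the number of terms
-- of any signed sum of powers of two equal to k.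
module Submission where

open import Defs
open import Level using (Level)
open import Data.Nat using (ℕ; zero; suc; _+_; _*_; _^_; _/_; _%_; _≡ᵇ_; _≤_; _<_; z≤n; s≤s; ∣_-_∣)
open import Data.Nat.Properties
open import Data.Nat.DivMod using (%-remove-+ʳ; /-congˡ; m*n/n≡m; +-distrib-/-∣ʳ; m/n<m)
open import Data.Nat.Divisibility using (m∣m*n)
open import Data.Nat.Induction using (<-wellFounded)
open import Data.Nat.ListAction using (sum)
open import Data.Nat.ListAction.Properties using (sum-++)
open import Data.Nat.Tactic.RingSolver using (solve-∀)
open import Induction.WellFounded using (Acc; acc)
open import Data.Bool using (true; false; _∧_; if_then_else_)
open import Data.Product using (Σ-syntax; _×_; _,_; proj₁; proj₂)
open import Data.Sum using (_⊎_; inj₁; inj₂)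
open import Data.List using (List; []; _∷_; _++_; map; length; filter)
open import Data.List.Properties using (length-++; length-map; map-++; filter-++; filter-≐; filter-none)
open import Data.List.Relation.Unary.Any as Any using (Any; toSum; fromSum; any?)
open import Data.List.Relation.Unary.Any.Properties using (map⁺; map⁻)
open import Data.List.Relation.Unary.All using (universal)
open import Data.Vec using ([]; _∷_; here)
open import Data.Fin.Subset using (Subset; _⊆_; _∩_; inside; outside; ∣_∣)
open import Data.Fin.Subset.Properties using (_⊆?_; p∩q⊆p; p∩q⊆q; x∈p∩q⁺; out⊆; in⊆in; drop-∷-⊆)
open import Relation.Nullary using (does; contradiction)
open import Relation.Unary as U using (Pred; Decidable; _≐_)
open import Relation.Unary.Properties using (_∪?_; _∩?_)
open import Relation.Binary.PropositionalEquality
open import Function using (_∘_)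

[2n]%2≡0 : ∀ n → 2 * n % 2 ≡ 0
[2n]%2≡0 n = %-remove-+ʳ 0 {d = 2} (m∣m*n n)

[1+2n]%2≡1 : ∀ n → (1 + 2 * n) % 2 ≡ 1
[1+2n]%2≡1 n = %-remove-+ʳ 1 {d = 2} (m∣m*n n)

[2n]/2≡n : ∀ n → 2 * n / 2 ≡ n
[2n]/2≡n n = trans (/-congˡ (*-comm 2 n)) (m*n/n≡m n 2)

[1+2n]/2≡n : ∀ n → (1 + 2 * n) / 2 ≡ n
[1+2n]/2≡n n = trans (+-distrib-/-∣ʳ 1 {d = 2} (m∣m*n n)) ([2n]/2≡n n)

n≤1+f⇒n/2≤f : ∀ {n f} → n ≤ suc f → n / 2 ≤ f
n≤1+f⇒n/2≤f {zero}  _   = z≤n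
n≤1+f⇒n/2≤f {suc n} n≤f = ≤-pred (≤-trans (m/n<m (suc n) 2 (s≤s (s≤s z≤n))) n≤f)

blGo-fuel : ∀ {f g} n → n ≤ f → n ≤ g → blGo f n ≡ blGo g n
blGo-fuel {zero}  {zero}  _ _   _   = refl
blGo-fuel {zero}  {suc g} 0 z≤n _   = blGo-fuel {zero} {g} 0 z≤n z≤n
blGo-fuel {suc f} {zero}  0 _   z≤n = blGo-fuel {f} {zero} 0 z≤n z≤n
blGo-fuel {suc f} {suc g} n n≤f n≤g =
  cong ((if (n % 2 ≡ᵇ 1) ∧ (n / 2 % 2 ≡ᵇ 0) then 1 else 0) +_)
       (blGo-fuel (n / 2) (n≤1+f⇒n/2≤f n≤f) (n≤1+f⇒n/2≤f n≤g))

bl-step : ∀ n → bl n ≡ (if (n % 2 ≡ᵇ 1) ∧ (n / 2 % 2 ≡ᵇ 0) then 1 else 0) + bl (n / 2)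
bl-step zero        = refl
bl-step n@(suc m) =
  cong ((if (n % 2 ≡ᵇ 1) ∧ (n / 2 % 2 ≡ᵇ 0) then 1 else 0) +_)
       (blGo-fuel {m} (n / 2) (n≤1+f⇒n/2≤f ≤-refl) ≤-refl)

bl[2n]≡bl[n] : ∀ n → bl (2 * n) ≡ bl n
bl[2n]≡bl[n] n rewrite bl-step (2 * n) | [2n]%2≡0 n | [2n]/2≡n n = refl

bl[1+4n]≡1+bl[n] : ∀ n → bl (1 + 2 * (2 * n)) ≡ suc (bl n)
bl[1+4n]≡1+bl[n] n
  rewrite bl-step (1 + 2 * (2 * n)) | [1+2n]%2≡1 (2 * n) | [1+2n]/2≡n (2 * n) | [2n]%2≡0 n
  = cong suc (bl[2n]≡bl[n] n)

bl[3+4n]≡bl[1+2n] : ∀ n → bl (1 + 2 * (1 + 2 * n)) ≡ bl (1 + 2 * n)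
bl[3+4n]≡bl[1+2n] n
  rewrite bl-step (1 + 2 * (1 + 2 * n)) | [1+2n]%2≡1 (1 + 2 * n) | [1+2n]/2≡n (1 + 2 * n) | [1+2n]%2≡1 n
  = refl

data Parity : ℕ → Set where
  even : ∀ j → Parity (2 * j)
  odd  : ∀ j → Parity (1 + 2 * j)

parity : ∀ n → Parity n
parity zero = even 0
parity (suc n) with parity n
... | even j = odd j
... | odd j  = subst Parity (*-suc 2 j) (even (suc j))

bl[1+2n]≡bl[n]⊎1+bl[n] : ∀ n → bl (1 + 2 * n) ≡ bl n ⊎ bl (1 + 2 * n) ≡ suc (bl n)
bl[1+2n]≡bl[n]⊎1+bl[n] n with parity n
... | even j = inj₂ (trans (bl[1+4n]≡1+bl[n] j) (cong suc (sym (bl[2n]≡bl[n] j))))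
... | odd j  = inj₁ (bl[3+4n]≡bl[1+2n] j)

bl[1+2n]≡bl[1+n]⊎1+bl[1+n] : ∀ n → bl (1 + 2 * n) ≡ bl (suc n) ⊎ bl (1 + 2 * n) ≡ suc (bl (suc n))
bl[1+2n]≡bl[1+n]⊎1+bl[1+n] n = go n (<-wellFounded n)
  where
  go : ∀ n → Acc _<_ n → bl (1 + 2 * n) ≡ bl (suc n) ⊎ bl (1 + 2 * n) ≡ suc (bl (suc n))
  go n _ with parity n
  ... | even j = subst (λ x → x ≡ bl (1 + 2 * j) ⊎ x ≡ suc (bl (1 + 2 * j)))
                   (sym (bl[1+4n]≡1+bl[n] j)) (swap (bl[1+2n]≡bl[n]⊎1+bl[n] j))
    where
    swap : ∀ {m n} → n ≡ m ⊎ n ≡ suc m → suc m ≡ n ⊎ suc m ≡ suc n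
    swap (inj₁ refl) = inj₂ refl
    swap (inj₂ refl) = inj₁ refl
  go _ (acc rs) | odd j =
    subst₂ (λ x y → x ≡ y ⊎ x ≡ suc y) (sym (bl[3+4n]≡bl[1+2n] j)) (sym bl[2+2j]≡bl[1+j])
      (go j (rs (s≤s (m≤m+n j (j + 0)))))
    where
    bl[2+2j]≡bl[1+j] : bl (2 + 2 * j) ≡ bl (suc j)
    bl[2+2j]≡bl[1+j] = trans (cong bl (sym (*-suc 2 j))) (bl[2n]≡bl[n] (suc j))

∣n-1+n∣≡1 : ∀ n → ∣ n - suc n ∣ ≡ 1
∣n-1+n∣≡1 zero    = refl
∣n-1+n∣≡1 (suc n) = ∣n-1+n∣≡1 n

n≡m⊎n≡1+m⇒∣m-n∣≤1×∣1+m-n∣≤1 : ∀ {m n} → n ≡ m ⊎ n ≡ suc m → ∣ m - n ∣ ≤ 1 × ∣ suc m - n ∣ ≤ 1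
n≡m⊎n≡1+m⇒∣m-n∣≤1×∣1+m-n∣≤1 {m} (inj₁ refl) =
  ≤-trans (≤-reflexive (∣n-n∣≡0 m)) z≤n , ≤-reflexive (trans (∣-∣-comm (suc m) m) (∣n-1+n∣≡1 m))
n≡m⊎n≡1+m⇒∣m-n∣≤1×∣1+m-n∣≤1 {m} (inj₂ refl) =
  ≤-reflexive (∣n-1+n∣≡1 m) , ≤-trans (≤-reflexive (∣n-n∣≡0 m)) z≤n

[1+2n]+1≡2[1+n] : ∀ n → 1 + 2 * n + 1 ≡ 2 * suc n
[1+2n]+1≡2[1+n] n = trans (+-comm (1 + 2 * n) 1) (sym (*-suc 2 n))

∣bl[n]-bl[n+1]∣≤1 : ∀ n → ∣ bl n - bl (n + 1) ∣ ≤ 1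
∣bl[n]-bl[n+1]∣≤1 n with parity n
... | even j = subst₂ (λ x y → ∣ x - y ∣ ≤ 1)
  (sym (bl[2n]≡bl[n] j)) (cong bl (+-comm 1 (2 * j)))
  (proj₁ (n≡m⊎n≡1+m⇒∣m-n∣≤1×∣1+m-n∣≤1 (bl[1+2n]≡bl[n]⊎1+bl[n] j)))
... | odd j = subst (λ y → ∣ bl (1 + 2 * j) - y ∣ ≤ 1)
  (trans (sym (bl[2n]≡bl[n] (suc j))) (cong bl (sym ([1+2n]+1≡2[1+n] j))))
  (subst (_≤ 1) (∣-∣-comm (bl (suc j)) (bl (1 + 2 * j)))
    (proj₁ (n≡m⊎n≡1+m⇒∣m-n∣≤1×∣1+m-n∣≤1 (bl[1+2n]≡bl[1+n]⊎1+bl[1+n] j))))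

∣bl[1+2n]-bl[1+2[n+1]]∣≤1 : ∀ n → ∣ bl (1 + 2 * n) - bl (1 + 2 * (n + 1)) ∣ ≤ 1
∣bl[1+2n]-bl[1+2[n+1]]∣≤1 n with parity n
... | even j = subst₂ (λ x y → ∣ x - y ∣ ≤ 1)
  (sym (bl[1+4n]≡1+bl[n] j))
  (trans (sym (bl[3+4n]≡bl[1+2n] j)) (cong (λ m → bl (1 + 2 * m)) (+-comm 1 (2 * j))))
  (proj₂ (n≡m⊎n≡1+m⇒∣m-n∣≤1×∣1+m-n∣≤1 (bl[1+2n]≡bl[n]⊎1+bl[n] j)))
... | odd j = subst₂ (λ x y → ∣ x - y ∣ ≤ 1)
  (sym (bl[3+4n]≡bl[1+2n] j))
  (trans (sym (bl[1+4n]≡1+bl[n] (suc j))) (cong (λ m → bl (1 + 2 * m)) (sym ([1+2n]+1≡2[1+n] j))))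
  (subst (_≤ 1) (∣-∣-comm (suc (bl (suc j))) (bl (1 + 2 * j)))
    (proj₂ (n≡m⊎n≡1+m⇒∣m-n∣≤1×∣1+m-n∣≤1 (bl[1+2n]≡bl[1+n]⊎1+bl[1+n] j))))

2n+2^[1+a]≡2[n+2^a] : ∀ n a → 2 * n + 2 ^ suc a ≡ 2 * (n + 2 ^ a)
2n+2^[1+a]≡2[n+2^a] n a = sym (*-distribˡ-+ 2 n (2 ^ a))

-- bl (1 + 2n) depends on the parity of n and not only on bl n, so odd arguments get their own
-- statement; both recursions then shrink the exponent.
mutual
  ∣bl[n]-bl[n+2^a]∣≤1 : ∀ n a → ∣ bl n - bl (n + 2 ^ a) ∣ ≤ 1
  ∣bl[n]-bl[n+2^a]∣≤1 n zero = ∣bl[n]-bl[n+1]∣≤1 n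
  ∣bl[n]-bl[n+2^a]∣≤1 n (suc a) with parity n
  ... | even j rewrite 2n+2^[1+a]≡2[n+2^a] j a | bl[2n]≡bl[n] j | bl[2n]≡bl[n] (j + 2 ^ a) =
    ∣bl[n]-bl[n+2^a]∣≤1 j a
  ... | odd j rewrite 2n+2^[1+a]≡2[n+2^a] j a =
    ∣bl[1+2n]-bl[1+2[n+2^a]]∣≤1 j a

  ∣bl[1+2n]-bl[1+2[n+2^a]]∣≤1 : ∀ n a → ∣ bl (1 + 2 * n) - bl (1 + 2 * (n + 2 ^ a)) ∣ ≤ 1
  ∣bl[1+2n]-bl[1+2[n+2^a]]∣≤1 n zero = ∣bl[1+2n]-bl[1+2[n+1]]∣≤1 n
  ∣bl[1+2n]-bl[1+2[n+2^a]]∣≤1 n (suc a) with parity n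
  ... | even j rewrite 2n+2^[1+a]≡2[n+2^a] j a | bl[1+4n]≡1+bl[n] j | bl[1+4n]≡1+bl[n] (j + 2 ^ a) =
    ∣bl[n]-bl[n+2^a]∣≤1 j a
  ... | odd j rewrite 2n+2^[1+a]≡2[n+2^a] j a | bl[3+4n]≡bl[1+2n] j | bl[3+4n]≡bl[1+2n] (j + 2 ^ a) =
    ∣bl[1+2n]-bl[1+2[n+2^a]]∣≤1 j a

-- Signed sums of powers of two

powerSum : List ℕ → ℕ
powerSum es = sum (map (2 ^_) es)

powerSum-++ : ∀ es fs → powerSum (es ++ fs) ≡ powerSum es + powerSum fs
powerSum-++ es fs = trans (cong sum (map-++ (2 ^_) es fs)) (sum-++ (map (2 ^_) es) (map (2 ^_) fs))

∣bl[n]-bl[n+powerSum]∣≤length : ∀ n es → ∣ bl n - bl (n + powerSum es) ∣ ≤ length es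
∣bl[n]-bl[n+powerSum]∣≤length n [] =
  ≤-reflexive (trans (cong (λ m → ∣ bl n - bl m ∣) (+-identityʳ n)) (∣n-n∣≡0 (bl n)))
∣bl[n]-bl[n+powerSum]∣≤length n (e ∷ es) = begin
  ∣ bl n - bl (n + (2 ^ e + powerSum es)) ∣
    ≡⟨ cong (λ m → ∣ bl n - bl m ∣) (sym (+-assoc n (2 ^ e) (powerSum es))) ⟩
  ∣ bl n - bl (n + 2 ^ e + powerSum es) ∣
    ≤⟨ ∣-∣-triangle (bl n) (bl (n + 2 ^ e)) _ ⟩
  ∣ bl n - bl (n + 2 ^ e) ∣ + ∣ bl (n + 2 ^ e) - bl (n + 2 ^ e + powerSum es) ∣
    ≤⟨ +-mono-≤ (∣bl[n]-bl[n+2^a]∣≤1 n e) (∣bl[n]-bl[n+powerSum]∣≤length (n + 2 ^ e) es) ⟩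
  suc (length es) ∎
  where open ≤-Reasoning

record SignedPowerSum (k : ℕ) : Set where
  field
    plus minus : List ℕ
    balanced   : k + powerSum minus ≡ powerSum plus

  terms : ℕ
  terms = length plus + length minus

open SignedPowerSum

bl≤terms : ∀ {k} (r : SignedPowerSum k) → bl k ≤ terms r
bl≤terms {k} r = begin
  bl k
    ≤⟨ m≤n+∣m-n∣ (bl k) (bl (k + powerSum (minus r))) ⟩
  bl (k + powerSum (minus r)) + ∣ bl k - bl (k + powerSum (minus r)) ∣
    ≤⟨ +-mono-≤ (≤-reflexive (cong bl (balanced r))) (∣bl[n]-bl[n+powerSum]∣≤length k (minus r)) ⟩
  bl (powerSum (plus r)) + length (minus r)
    ≤⟨ +-monoˡ-≤ (length (minus r)) (∣bl[n]-bl[n+powerSum]∣≤length 0 (plus r)) ⟩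
  terms r ∎
  where open ≤-Reasoning

signed-2^e+a-c : ∀ {k a c} e → k + c ≡ 2 ^ e + a → SignedPowerSum a → SignedPowerSum c → SignedPowerSum k
signed-2^e+a-c {k} {a} {c} e k+c≡2^e+a ra rc = record
  { plus     = e ∷ plus ra ++ minus rc
  ; minus    = minus ra ++ plus rc
  ; balanced = begin
      k + powerSum (minus ra ++ plus rc)
        ≡⟨ cong (k +_) (trans (powerSum-++ (minus ra) (plus rc)) (cong (powerSum (minus ra) +_) (sym (balanced rc)))) ⟩
      k + (powerSum (minus ra) + (c + powerSum (minus rc)))
        ≡⟨ regroup₁ k (powerSum (minus ra)) c (powerSum (minus rc)) ⟩
      (k + c) + (powerSum (minus ra) + powerSum (minus rc))
        ≡⟨ cong (_+ (powerSum (minus ra) + powerSum (minus rc))) k+c≡2^e+a ⟩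
      (2 ^ e + a) + (powerSum (minus ra) + powerSum (minus rc))
        ≡⟨ regroup₂ a (2 ^ e) (powerSum (minus ra)) (powerSum (minus rc)) ⟩
      2 ^ e + ((a + powerSum (minus ra)) + powerSum (minus rc))
        ≡⟨ cong (λ m → 2 ^ e + (m + powerSum (minus rc))) (balanced ra) ⟩
      2 ^ e + (powerSum (plus ra) + powerSum (minus rc))
        ≡⟨ cong (2 ^ e +_) (sym (powerSum-++ (plus ra) (minus rc))) ⟩
      powerSum (e ∷ plus ra ++ minus rc) ∎
  }
  where
  open ≡-Reasoning
  regroup₁ : ∀ k n c m → k + (n + (c + m)) ≡ (k + c) + (n + m)
  regroup₁ = solve-∀
  regroup₂ : ∀ a t n m → (t + a) + (n + m) ≡ t + ((a + n) + m)
  regroup₂ = solve-∀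

terms-signed-2^e+a-c : ∀ {k a c} e (eq : k + c ≡ 2 ^ e + a) (ra : SignedPowerSum a) (rc : SignedPowerSum c) →
                        terms (signed-2^e+a-c e eq ra rc) ≡ suc (terms ra + terms rc)
terms-signed-2^e+a-c e eq ra rc
  rewrite length-++ (plus ra) {minus rc} | length-++ (minus ra) {plus rc} =
  cong suc (regroup (length (plus ra)) (length (minus rc)) (length (minus ra)) (length (plus rc)))
  where
  regroup : ∀ p m n q → (p + m) + (n + q) ≡ (p + n) + (q + m)
  regroup = solve-∀

-- Counting ID 𝒮 by inclusion–exclusion

module _ {a p q : Level} {A : Set a} {P : Pred A p} {Q : Pred A q} (P? : Decidable P) (Q? : Decidable Q) where

  length-filter-∪+∩ : ∀ xs → length (filter (P? ∪? Q?) xs) + length (filter (P? ∩? Q?) xs)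
                            ≡ length (filter P? xs) + length (filter Q? xs)
  length-filter-∪+∩ [] = refl
  length-filter-∪+∩ (x ∷ xs) with does (P? x) | does (Q? x) | length-filter-∪+∩ xs
  ... | true  | true  | ih = cong suc (trans (+-suc _ _) (trans (cong suc ih) (sym (+-suc _ _))))
  ... | true  | false | ih = cong suc ih
  ... | false | true  | ih = trans (cong suc ih) (sym (+-suc _ _))
  ... | false | false | ih = ih

length-filter-map : ∀ {a b p} {A : Set a} {B : Set b} {P : Pred B p} (P? : Decidable P) (f : A → B) xs →
                    length (filter P? (map f xs)) ≡ length (filter (P? ∘ f) xs)
length-filter-map P? f [] = refl
length-filter-map P? f (x ∷ xs) with does (P? (f x))
... | true  = cong suc (length-filter-map P? f xs)
... | false = length-filter-map P? f xs

length-filter-++ : ∀ {a p} {A : Set a} {P : Pred A p} (P? : Decidable P) xs ys →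
                   length (filter P? (xs ++ ys)) ≡ length (filter P? xs) + length (filter P? ys)
length-filter-++ P? xs ys = trans (cong length (filter-++ P? xs ys)) (length-++ (filter P? xs))

length-filter-⊆-allSubsets : ∀ {n} (S : Subset n) → length (filter (_⊆? S) (allSubsets n)) ≡ 2 ^ ∣ S ∣
length-filter-⊆-allSubsets {zero}  []      = refl
length-filter-⊆-allSubsets {suc n} (s ∷ S) = begin
  length (filter (_⊆? (s ∷ S)) (allSubsets (suc n)))
    ≡⟨ length-filter-++ (_⊆? (s ∷ S)) (map (outside ∷_) Ts) (map (inside ∷_) Ts) ⟩
  length (filter (_⊆? (s ∷ S)) (map (outside ∷_) Ts)) + length (filter (_⊆? (s ∷ S)) (map (inside ∷_) Ts))
    ≡⟨ cong (_+ length (filter (_⊆? (s ∷ S)) (map (inside ∷_) Ts))) (trans outside∷ (length-filter-⊆-allSubsets S)) ⟩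
  2 ^ ∣ S ∣ + length (filter (_⊆? (s ∷ S)) (map (inside ∷_) Ts))
    ≡⟨ inside∷ s ⟩
  2 ^ ∣ s ∷ S ∣ ∎
  where
  open ≡-Reasoning
  Ts = allSubsets n

  outside∷ : length (filter (_⊆? (s ∷ S)) (map (outside ∷_) Ts)) ≡ length (filter (_⊆? S) Ts)
  outside∷ = trans (length-filter-map (_⊆? (s ∷ S)) (outside ∷_) Ts)
                   (cong length (filter-≐ _ (_⊆? S) (drop-∷-⊆ , out⊆) Ts))

  inside∷ : ∀ s → 2 ^ ∣ S ∣ + length (filter (_⊆? (s ∷ S)) (map (inside ∷_) Ts)) ≡ 2 ^ ∣ s ∷ S ∣
  inside∷ inside = cong (2 ^ ∣ S ∣ +_) (begin
    length (filter (_⊆? (inside ∷ S)) (map (inside ∷_) Ts))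
      ≡⟨ length-filter-map (_⊆? (inside ∷ S)) (inside ∷_) Ts ⟩
    length (filter (λ T → (inside ∷ T) ⊆? (inside ∷ S)) Ts)
      ≡⟨ cong length (filter-≐ _ (_⊆? S) (drop-∷-⊆ , in⊆in) Ts) ⟩
    length (filter (_⊆? S) Ts)
      ≡⟨ length-filter-⊆-allSubsets S ⟩
    2 ^ ∣ S ∣
      ≡⟨ sym (+-identityʳ (2 ^ ∣ S ∣)) ⟩
    2 ^ ∣ S ∣ + 0 ∎)
  inside∷ outside = trans (cong (2 ^ ∣ S ∣ +_) (begin
    length (filter (_⊆? (outside ∷ S)) (map (inside ∷_) Ts))
      ≡⟨ length-filter-map (_⊆? (outside ∷ S)) (inside ∷_) Ts ⟩
    length (filter (λ T → (inside ∷ T) ⊆? (outside ∷ S)) Ts)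
      ≡⟨ cong length (filter-none _ (universal (λ _ T⊆S → contradiction (T⊆S here) λ ()) Ts)) ⟩
    0 ∎)) (+-identityʳ (2 ^ ∣ S ∣))

module _ {n : ℕ} where

  covered? : (𝒮 : List (Subset n)) → Decidable (λ T → Any (T ⊆_) 𝒮)
  covered? 𝒮 T = any? (T ⊆?_) 𝒮

  ⊆-∩⁻ : ∀ {T U V : Subset n} → T ⊆ U ∩ V → T ⊆ U × T ⊆ V
  ⊆-∩⁻ {U = U} {V} T⊆U∩V = (λ x∈T → p∩q⊆p U V (T⊆U∩V x∈T)) , (λ x∈T → p∩q⊆q U V (T⊆U∩V x∈T))

  ⊆-∩⁺ : ∀ {T U V : Subset n} → T ⊆ U → T ⊆ V → T ⊆ U ∩ V
  ⊆-∩⁺ T⊆U T⊆V x∈T = x∈p∩q⁺ (T⊆U x∈T , T⊆V x∈T)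

  covered-map-∩ : ∀ S 𝒮 → (λ T → Any (T ⊆_) (map (S ∩_) 𝒮)) ≐ ((_⊆ S) U.∩ (λ T → Any (T ⊆_) 𝒮))
  covered-map-∩ S 𝒮 = to , from
    where
    to : ∀ {T} → Any (T ⊆_) (map (S ∩_) 𝒮) → T ⊆ S × Any (T ⊆_) 𝒮
    to h = proj₁ (⊆-∩⁻ (proj₂ (Any.satisfied (map⁻ h)))) , Any.map (proj₂ ∘ ⊆-∩⁻) (map⁻ h)
    from : ∀ {T} → T ⊆ S × Any (T ⊆_) 𝒮 → Any (T ⊆_) (map (S ∩_) 𝒮)
    from (T⊆S , h) = map⁺ (Any.map (⊆-∩⁺ T⊆S) h)

  sizeID-[] : sizeID {n} [] ≡ 0
  sizeID-[] = cong length (filter-none (covered? []) (universal (λ _ ()) (allSubsets n)))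

  sizeID-∷+sizeID-map-∩ : ∀ S 𝒮 → sizeID (S ∷ 𝒮) + sizeID (map (S ∩_) 𝒮) ≡ 2 ^ ∣ S ∣ + sizeID 𝒮
  sizeID-∷+sizeID-map-∩ S 𝒮 = begin
    sizeID (S ∷ 𝒮) + sizeID (map (S ∩_) 𝒮)
      ≡⟨ cong₂ _+_ (cong length (filter-≐ (covered? (S ∷ 𝒮)) ((_⊆? S) ∪? covered? 𝒮) (toSum , fromSum) all))
                   (cong length (filter-≐ (covered? (map (S ∩_) 𝒮)) ((_⊆? S) ∩? covered? 𝒮) (covered-map-∩ S 𝒮) all)) ⟩
    length (filter ((_⊆? S) ∪? covered? 𝒮) all) + length (filter ((_⊆? S) ∩? covered? 𝒮) all)
      ≡⟨ length-filter-∪+∩ (_⊆? S) (covered? 𝒮) all ⟩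
    length (filter (_⊆? S) all) + sizeID 𝒮
      ≡⟨ cong (_+ sizeID 𝒮) (length-filter-⊆-allSubsets S) ⟩
    2 ^ ∣ S ∣ + sizeID 𝒮 ∎
    where
    open ≡-Reasoning
    all = allSubsets n

2+m+n≤2x : ∀ {m n x} → suc m ≤ x → suc n ≤ x → suc (suc (m + n)) ≤ 2 * x
2+m+n≤2x {m} {n} {x} 1+m≤x 1+n≤x = begin
  suc (suc (m + n)) ≡⟨ cong suc (sym (+-suc m n)) ⟩
  suc m + suc n     ≤⟨ +-mono-≤ 1+m≤x 1+n≤x ⟩
  x + x             ≡⟨ cong (x +_) (sym (+-identityʳ x)) ⟩
  2 * x             ∎
  where open ≤-Reasoning

signedPowerSum-sizeID : ∀ {n} (𝒮 : List (Subset n)) → Σ[ r ∈ SignedPowerSum (sizeID 𝒮) ] suc (terms r) ≤ 2 ^ length 𝒮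
signedPowerSum-sizeID 𝒮 = go (length 𝒮) 𝒮 refl
  where
  go : ∀ {n} t (𝒮 : List (Subset n)) → length 𝒮 ≡ t → Σ[ r ∈ SignedPowerSum (sizeID 𝒮) ] suc (terms r) ≤ 2 ^ t
  go {n} zero [] _ = record { plus = [] ; minus = [] ; balanced = trans (+-identityʳ _) (sizeID-[] {n}) } , ≤-refl
  go (suc t) (S ∷ 𝒮) |S∷𝒮|≡1+t
    with go t 𝒮 (suc-injective |S∷𝒮|≡1+t)
       | go t (map (S ∩_) 𝒮) (trans (length-map (S ∩_) 𝒮) (suc-injective |S∷𝒮|≡1+t))
  ... | ra , 1+|ra|≤2^t | rc , 1+|rc|≤2^t =
    signed-2^e+a-c ∣ S ∣ (sizeID-∷+sizeID-map-∩ S 𝒮) ra rc ,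
    subst (_≤ 2 ^ suc t) (cong suc (sym (terms-signed-2^e+a-c ∣ S ∣ (sizeID-∷+sizeID-map-∩ S 𝒮) ra rc)))
      (2+m+n≤2x 1+|ra|≤2^t 1+|rc|≤2^t)

corollary16 : (k : ℕ) → 1 ≤ k →
    (n : ℕ) → (𝒮 : List (Subset n)) → sizeID 𝒮 ≡ k →
    suc (bl k) ≤ 2 ^ length 𝒮
corollary16 _ _ _ 𝒮 refl with signedPowerSum-sizeID 𝒮
... | r , 1+terms≤2^t = ≤-trans (s≤s (bl≤terms r)) 1+terms≤2^t
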